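{- Let $p$ and $s$ be positive integers and let $i$ be any positive divisor of $p$. Then there exists a graph $H$ on $sp$ vertices admitting an optimal order whose $\delta$-sequence is $$\delta_H=(\{0,1,\dots,p-1\},\;\{p-i,\dots,(p-i)+p-1\},\;\dots,\;\{(s-1)(p-i),\dots,(s-1)(p-i)+p-1\}),$$ i.e. $\delta_H(jp+r+1)=j(p-i)+r$ for all $0\leq j\leq s-1$ and $0\leq r\leq p-1$.
   Context: For a graph $G=(V,E)$ and $A\subseteq V$, let $I(A)$ be the set of edges with both endpoints in $A$, and $I(m)=\max_{A\subseteq V,|A|=m}|I(A)|$. A set $A$ with $|A|=m$ is optimal if $|I(A)|=I(m)$; an optimal order is a total order on $V$ all of whose initial segments are optimal sets. The $\delta$-sequence of $G$ is $(\delta(1),\dots,\delta(|V|))$ with $\delta(1)=0$ and $\delta(m)=I(m)-I(m-1)$ for $m\ge 2$. -}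

module Defs where

open import Data.Nat using (ℕ; zero; suc; _+_; _∸_; _⊔_; _<ᵇ_; _≡ᵇ_; _≤_)
open import Data.Bool using (Bool; true; false; if_then_else_; _∧_)
open import Data.Fin using (Fin; toℕ) renaming (zero to fzero; suc to fsuc)
open import Data.Fin.Subset using (Subset; _∈_; ∣_∣)
open import Data.Vec using (Vec; []; _∷_; tabulate; lookup)
open import Data.List using (List; []; _∷_; map; _++_; foldr)
open import Data.Fin.Permutation using (Permutation′; _⟨$⟩ˡ_; _⟨$⟩ʳ_)
open import Relation.Binary.PropositionalEquality using (_≡_)
open import Data.Product using (Σ; _×_)

record Graph (n : ℕ) : Set where
  field
    adj    : Fin n → Fin n → Bool
    sym    : ∀ u v → adj u v ≡ adj v u
    irrefl : ∀ v → adj v v ≡ false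
open Graph public

sumFin : {n : ℕ} → (Fin n → ℕ) → ℕ
sumFin {zero}  f = 0
sumFin {suc n} f = f fzero + sumFin (λ k → f (fsuc k))

edgesIn : {n : ℕ} → Graph n → Subset n → ℕ
edgesIn G A = sumFin λ u → sumFin λ v →
  if (lookup A u ∧ lookup A v ∧ (toℕ u <ᵇ toℕ v) ∧ adj G u v) then 1 else 0

allSubsets : (n : ℕ) → List (Subset n)
allSubsets zero    = [] ∷ []
allSubsets (suc n) = map (true ∷_) (allSubsets n) ++ map (false ∷_) (allSubsets n)

-- I(m) = max { |I(A)| : A ⊆ V, |A| = m }  (0 if there is no such A, i.e. m > n)
Imax : {n : ℕ} → Graph n → ℕ → ℕ
Imax {n} G m = foldr (λ A acc → (if sizeIs A then edgesIn G A else 0) ⊔ acc) 0 (allSubsets n)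
  where
  sizeIs : Subset n → Bool
  sizeIs A = ∣ A ∣ ≡ᵇ m

Optimal : {n : ℕ} → Graph n → Subset n → Set
Optimal G A = edgesIn G A ≡ Imax G ∣ A ∣

-- A total order on V given as a permutation σ (σ ⟨$⟩ʳ k = the k-th vertex, 0-based);
-- initial segment of length m = the first m vertices.
initialSegment : {n : ℕ} → Permutation′ n → ℕ → Subset n
initialSegment σ m = tabulate λ v → toℕ (σ ⟨$⟩ˡ v) <ᵇ m

OptimalOrder : {n : ℕ} → Graph n → Permutation′ n → Set
OptimalOrder {n} G σ = ∀ m → m ≤ n → Optimal G (initialSegment σ m)

-- δ-sequence: δ(1) = 0, δ(m) = I(m) − I(m−1) for m ≥ 2 (δ(0) unused, set to 0)
δ : {n : ℕ} → Graph n → ℕ → ℕ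
δ G zero          = 0
δ G (suc zero)    = 0
δ G (suc (suc m)) = Imax G (suc (suc m)) ∸ Imax G (suc m)

module Submission where

-- The graph is the complement of q = p / i disjoint copies of the complete s-partite graph with parts
-- of size i, its vertices numbered level by level. Maximising edges means minimising non-edges. Inside
-- one copy, a vertices span at least h(a) non-edges, the number obtained by filling the parts one after
-- the other; as h is convex, m vertices spread over the q copies span at least H(m), the number obtained
-- by spreading them as evenly as possible. The first m vertices attain H(m), so the numbering is an
-- optimal order, and vertex x gains x − i ⌊x / p⌋ edges: it misses the i ⌊x / p⌋ earlier vertices of
-- its column.

open import Defs hiding (sym)
open import Data.Bool using (Bool; true; false; if_then_else_; _∧_; _∨_; not)
open import Data.Bool.Properties using (T-≡; ∧-zeroʳ; ∧-identityʳ)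
open import Data.Empty using (⊥-elim)
open import Data.Fin using (Fin; toℕ; fromℕ<) renaming (zero to fzero; suc to fsuc)
open import Data.Fin.Permutation using (Permutation′) renaming (id to idₚ)
open import Data.Fin.Properties using (toℕ-fromℕ<)
open import Data.Fin.Subset using (Subset; ∣_∣)
open import Data.List using (List; []; _∷_; map; foldr)
open import Data.List.Membership.Propositional using (_∈_)
open import Data.List.Membership.Propositional.Properties using (∈-map⁺; ∈-++⁺ˡ; ∈-++⁺ʳ)
open import Data.List.Relation.Unary.Any using (here; there)
open import Data.Nat
open import Data.Nat.Combinatorics using (_C_; nC1≡n; nCk+nC[k+1]≡[n+1]C[k+1])
open import Data.Nat.DivMod
open import Data.Nat.Divisibility using (_∣_; divides)
open import Data.Nat.Properties
open import Data.Nat.Tactic.RingSolver using (solve-∀)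
open import Data.Product using (Σ; _×_; _,_)
open import Data.Sum using (inj₁; inj₂)
open import Data.Vec using ([]; _∷_; lookup)
open import Data.Vec.Properties using (lookup∘tabulate)
open import Function.Bundles using (Equivalence)
open import Relation.Binary.PropositionalEquality
open import Relation.Nullary using (¬_; Dec; yes; no)
open import Relation.Nullary.Reflects using (ofʸ)

infixr 5 _∙_
_∙_ : {A : Set} {x y z : A} → x ≡ y → y ≡ z → x ≡ z
_∙_ = trans

⟦_⟧ : Bool → ℕ
⟦ b ⟧ = if b then 1 else 0

⟦⟧≤1 : ∀ b → ⟦ b ⟧ ≤ 1
⟦⟧≤1 true  = s≤s z≤n
⟦⟧≤1 false = z≤n

⟦∧⟧ : ∀ a b → ⟦ a ∧ b ⟧ ≡ ⟦ a ⟧ * ⟦ b ⟧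
⟦∧⟧ true  b = sym (*-identityˡ ⟦ b ⟧)
⟦∧⟧ false b = refl

<⇒<ᵇ≡true : ∀ {m n} → m < n → (m <ᵇ n) ≡ true
<⇒<ᵇ≡true m<n = Equivalence.to T-≡ (<⇒<ᵇ m<n)

≮⇒<ᵇ≡false : ∀ {m n} → ¬ m < n → (m <ᵇ n) ≡ false
≮⇒<ᵇ≡false {m} {n} m≮n with m <ᵇ n | <ᵇ-reflects-< m n
... | false | _       = refl
... | true  | ofʸ m<n = ⊥-elim (m≮n m<n)

<ᵇ≡true⇒< : ∀ {m n} → (m <ᵇ n) ≡ true → m < n
<ᵇ≡true⇒< {m} {n} eq = <ᵇ⇒< m n (Equivalence.from T-≡ eq)

≡⇒≡ᵇ≡true : ∀ {m n} → m ≡ n → (m ≡ᵇ n) ≡ true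
≡⇒≡ᵇ≡true {m} {n} m≡n = Equivalence.to T-≡ (≡⇒≡ᵇ m n m≡n)

≡ᵇ≡true⇒≡ : ∀ {m n} → (m ≡ᵇ n) ≡ true → m ≡ n
≡ᵇ≡true⇒≡ {m} {n} eq = ≡ᵇ⇒≡ m n (Equivalence.from T-≡ eq)

≢⇒≡ᵇ≡false : ∀ {m n} → m ≢ n → (m ≡ᵇ n) ≡ false
≢⇒≡ᵇ≡false {m} {n} m≢n with m ≡ᵇ n in eq
... | false = refl
... | true  = ⊥-elim (m≢n (≡ᵇ≡true⇒≡ eq))

≡ᵇ-refl : ∀ n → (n ≡ᵇ n) ≡ true
≡ᵇ-refl n = ≡⇒≡ᵇ≡true {n} refl

≡ᵇ-comm : ∀ m n → (m ≡ᵇ n) ≡ (n ≡ᵇ m)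
≡ᵇ-comm zero    zero    = refl
≡ᵇ-comm zero    (suc n) = refl
≡ᵇ-comm (suc m) zero    = refl
≡ᵇ-comm (suc m) (suc n) = ≡ᵇ-comm m n

<ᵇ≡not≡ᵇ : ∀ {m n} → m ≤ n → (m <ᵇ n) ≡ not (m ≡ᵇ n)
<ᵇ≡not≡ᵇ {m} {n} m≤n with m <? n
... | yes m<n = <⇒<ᵇ≡true m<n ∙ cong not (sym (≢⇒≡ᵇ≡false (<⇒≢ m<n)))
... | no  m≮n = ≮⇒<ᵇ≡false m≮n ∙ cong not (sym (≡⇒≡ᵇ≡true (≤∧≮⇒≡ m≤n m≮n)))

-- Finite sums

Σ< : ℕ → (ℕ → ℕ) → ℕ
Σ< zero    f = 0
Σ< (suc n) f = f 0 + Σ< n (λ x → f (suc x))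

sumFin≡Σ< : ∀ n (f : ℕ → ℕ) → sumFin {n} (λ u → f (toℕ u)) ≡ Σ< n f
sumFin≡Σ< zero    f = refl
sumFin≡Σ< (suc n) f = cong (f 0 +_) (sumFin≡Σ< n (λ x → f (suc x)))

sumFin-cong : ∀ {n} {f g : Fin n → ℕ} → (∀ u → f u ≡ g u) → sumFin f ≡ sumFin g
sumFin-cong {zero}  f≗g = refl
sumFin-cong {suc n} f≗g = cong₂ _+_ (f≗g fzero) (sumFin-cong (λ u → f≗g (fsuc u)))

Σ<-cong : ∀ n {f g : ℕ → ℕ} → (∀ x → x < n → f x ≡ g x) → Σ< n f ≡ Σ< n g
Σ<-cong zero    f≗g = refl
Σ<-cong (suc n) f≗g = cong₂ _+_ (f≗g 0 z<s) (Σ<-cong n (λ x x<n → f≗g (suc x) (s<s x<n)))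

Σ<-mono-≤ : ∀ n {f g : ℕ → ℕ} → (∀ x → x < n → f x ≤ g x) → Σ< n f ≤ Σ< n g
Σ<-mono-≤ zero    f≤g = z≤n
Σ<-mono-≤ (suc n) f≤g = +-mono-≤ (f≤g 0 z<s) (Σ<-mono-≤ n (λ x x<n → f≤g (suc x) (s<s x<n)))

Σ<-distrib-+ : ∀ n (f g : ℕ → ℕ) → Σ< n (λ x → f x + g x) ≡ Σ< n f + Σ< n g
Σ<-distrib-+ zero    f g = refl
Σ<-distrib-+ (suc n) f g =
  cong (f 0 + g 0 +_) (Σ<-distrib-+ n (λ x → f (suc x)) (λ x → g (suc x)))
  ∙ +-comm-middle (f 0) (g 0) (Σ< n (λ x → f (suc x))) (Σ< n (λ x → g (suc x)))
  where
  +-comm-middle : ∀ a b c d → (a + b) + (c + d) ≡ (a + c) + (b + d)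
  +-comm-middle = solve-∀

Σ<-*ˡ : ∀ n c (f : ℕ → ℕ) → Σ< n (λ x → c * f x) ≡ c * Σ< n f
Σ<-*ˡ zero    c f = sym (*-zeroʳ c)
Σ<-*ˡ (suc n) c f = cong (c * f 0 +_) (Σ<-*ˡ n c (λ x → f (suc x))) ∙ sym (*-distribˡ-+ c (f 0) _)

Σ<-*ʳ : ∀ n c (f : ℕ → ℕ) → Σ< n (λ x → f x * c) ≡ Σ< n f * c
Σ<-*ʳ n c f = Σ<-cong n (λ x _ → *-comm (f x) c) ∙ Σ<-*ˡ n c f ∙ *-comm c (Σ< n f)

Σ<-const : ∀ n c → Σ< n (λ _ → c) ≡ n * c
Σ<-const zero    c = refl
Σ<-const (suc n) c = cong (c +_) (Σ<-const n c)

Σ<-zero : ∀ n {f : ℕ → ℕ} → (∀ x → x < n → f x ≡ 0) → Σ< n f ≡ 0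
Σ<-zero n f≗0 = Σ<-cong n f≗0 ∙ Σ<-const n 0 ∙ *-zeroʳ n

Σ<-split : ∀ a b (f : ℕ → ℕ) → Σ< (a + b) f ≡ Σ< a f + Σ< b (λ z → f (a + z))
Σ<-split zero    b f = refl
Σ<-split (suc a) b f = cong (f 0 +_) (Σ<-split a b (λ x → f (suc x))) ∙ sym (+-assoc (f 0) _ _)

Σ<-suc : ∀ n (f : ℕ → ℕ) → Σ< (suc n) f ≡ Σ< n f + f n
Σ<-suc n f = cong (λ k → Σ< k f) (+-comm 1 n) ∙ Σ<-split n 1 f
           ∙ cong (Σ< n f +_) (+-identityʳ (f (n + 0)) ∙ cong f (+-identityʳ n))

Σ<-blocks : ∀ a b (f : ℕ → ℕ) → Σ< (a * b) f ≡ Σ< a (λ j → Σ< b (λ r → f (j * b + r)))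
Σ<-blocks zero    b f = refl
Σ<-blocks (suc a) b f = Σ<-split b (a * b) f ∙ cong (Σ< b f +_)
  (Σ<-blocks a b (λ z → f (b + z))
   ∙ Σ<-cong a (λ j _ → Σ<-cong b (λ r _ → cong f (sym (+-assoc b (j * b) r)))))

Σ<-comm : ∀ a b (f : ℕ → ℕ → ℕ) →
          Σ< a (λ x → Σ< b (λ y → f x y)) ≡ Σ< b (λ y → Σ< a (λ x → f x y))
Σ<-comm zero    b f = sym (Σ<-zero b (λ _ _ → refl))
Σ<-comm (suc a) b f = cong (Σ< b (f 0) +_) (Σ<-comm a b (λ x → f (suc x)))
                    ∙ sym (Σ<-distrib-+ b (f 0) (λ y → Σ< a (λ x → f (suc x) y)))

Σ<-select : ∀ n c (f : ℕ → ℕ) → c < n → Σ< n (λ x → ⟦ x ≡ᵇ c ⟧ * f x) ≡ f c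
Σ<-select (suc n) zero    f _         = cong₂ _+_ (+-identityʳ (f 0)) (Σ<-zero n (λ _ _ → refl))
                                      ∙ +-identityʳ (f 0)
Σ<-select (suc n) (suc c) f (s<s c<n) = Σ<-select n c (λ x → f (suc x)) c<n

Σ<-restrict : ∀ {m n} (f : ℕ → ℕ) → m ≤ n → Σ< n (λ x → ⟦ x <ᵇ m ⟧ * f x) ≡ Σ< m f
Σ<-restrict {zero}  {n}     f _         = Σ<-zero n (λ _ _ → refl)
Σ<-restrict {suc m} {suc n} f (s≤s m≤n) =
  cong₂ _+_ (*-identityˡ (f 0)) (Σ<-restrict (λ x → f (suc x)) m≤n)

Σ<-count< : ∀ {m n} → m ≤ n → Σ< n (λ x → ⟦ x <ᵇ m ⟧) ≡ m
Σ<-count< {m} {n} m≤n = Σ<-cong n (λ x _ → sym (*-identityʳ ⟦ x <ᵇ m ⟧))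
                      ∙ Σ<-restrict (λ _ → 1) m≤n ∙ Σ<-const m 1 ∙ *-identityʳ m

[m*n+o]%n≡o : ∀ m n {o} .{{_ : NonZero n}} → o < n → (m * n + o) % n ≡ o
[m*n+o]%n≡o m n {o} o<n = %-congˡ (+-comm (m * n) o) ∙ [m+kn]%n≡m%n o m n ∙ m<n⇒m%n≡m o<n

[m*n+o]/n≡m : ∀ m n {o} .{{_ : NonZero n}} → o < n → (m * n + o) / n ≡ m
[m*n+o]/n≡m m n {o} o<n = +-distrib-/-∣ˡ o (divides m refl)
                        ∙ cong₂ _+_ (m*n/n≡m m n) (m<n⇒m/n≡0 o<n) ∙ +-identityʳ m

m<k∧o<n⇒m*n+o<k*n : ∀ {m n o k} → m < k → o < n → m * n + o < k * n
m<k∧o<n⇒m*n+o<k*n {m} {n} {o} {k} m<k o<n = begin-strict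
  m * n + o <⟨ +-monoʳ-< (m * n) o<n ⟩
  m * n + n ≡⟨ +-comm (m * n) n ⟩
  suc m * n ≤⟨ *-monoˡ-≤ n m<k ⟩
  k * n     ∎
  where open ≤-Reasoning

-- Greedy lower bounds

-- The supporting line of slope σ at c, with the terms moved so that no subtraction occurs.
Σ<-above-supporting-line : ∀ (d : ℕ → ℕ) c σ → (∀ y → y < c → d y ≤ σ) → (∀ y → c ≤ y → σ ≤ d y) →
                           ∀ a → Σ< c d + σ * a ≤ Σ< a d + σ * c
Σ<-above-supporting-line d c σ d<c≤σ σ≤d≥c a with ≤-total a c
... | inj₁ a≤c = begin
    Σ< c d + σ * a                        ≡⟨ cong (λ k → Σ< k d + σ * a) c≡a+e ⟩
    Σ< (a + e) d + σ * a                  ≡⟨ cong (_+ σ * a) (Σ<-split a e d) ⟩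
    Σ< a d + Σ< e (λ z → d (a + z)) + σ * a ≤⟨ +-monoˡ-≤ (σ * a) (+-monoʳ-≤ (Σ< a d) gap≤) ⟩
    Σ< a d + e * σ + σ * a                ≡⟨ rearrange (Σ< a d) e σ a ⟩
    Σ< a d + σ * (a + e)                  ≡⟨ cong (λ k → Σ< a d + σ * k) c≡a+e ⟨
    Σ< a d + σ * c                        ∎
  where
  open ≤-Reasoning
  e = c ∸ a
  c≡a+e : c ≡ a + e
  c≡a+e = sym (m+[n∸m]≡n a≤c)
  gap≤ : Σ< e (λ z → d (a + z)) ≤ e * σ
  gap≤ = ≤-trans (Σ<-mono-≤ e (λ z z<e → d<c≤σ (a + z) (subst (a + z <_) (sym c≡a+e) (+-monoʳ-< a z<e))))
                 (≤-reflexive (Σ<-const e σ))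
  rearrange : ∀ S e σ a → S + e * σ + σ * a ≡ S + σ * (a + e)
  rearrange = solve-∀
... | inj₂ c≤a = begin
    Σ< c d + σ * a                        ≡⟨ cong (λ k → Σ< c d + σ * k) a≡c+e ⟩
    Σ< c d + σ * (c + e)                  ≡⟨ rearrange (Σ< c d) e σ c ⟩
    Σ< c d + e * σ + σ * c                ≤⟨ +-monoˡ-≤ (σ * c) (+-monoʳ-≤ (Σ< c d) gap≥) ⟩
    Σ< c d + Σ< e (λ z → d (c + z)) + σ * c ≡⟨ cong (_+ σ * c) (Σ<-split c e d) ⟨
    Σ< (c + e) d + σ * c                  ≡⟨ cong (λ k → Σ< k d + σ * c) a≡c+e ⟨
    Σ< a d + σ * c                        ∎
  where
  open ≤-Reasoning
  e = a ∸ c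
  a≡c+e : a ≡ c + e
  a≡c+e = sym (m+[n∸m]≡n c≤a)
  gap≥ : e * σ ≤ Σ< e (λ z → d (c + z))
  gap≥ = ≤-trans (≤-reflexive (sym (Σ<-const e σ))) (Σ<-mono-≤ e (λ z _ → σ≤d≥c (c + z) (m≤m+n c z)))
  rearrange : ∀ S e σ c → S + σ * (c + e) ≡ S + e * σ + σ * c
  rearrange = solve-∀

crossPairs : ℕ → (ℕ → ℕ) → ℕ
crossPairs s b = Σ< s (λ j → Σ< s (λ j′ → ⟦ j <ᵇ j′ ⟧ * (b j * b j′)))

crossPairs-suc : ∀ s b → crossPairs (suc s) b ≡ b 0 * Σ< s (λ j → b (suc j)) + crossPairs s (λ j → b (suc j))
crossPairs-suc s b = cong (_+ crossPairs s (λ j → b (suc j)))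
  (Σ<-cong s (λ j _ → *-identityˡ (b 0 * b (suc j))) ∙ Σ<-*ˡ s (b 0) (λ j → b (suc j)))

-- h a is the fewest edges that a vertices span in a complete multipartite graph with parts of size i
-- (fill the parts one after the other); H m is the same for q disjoint copies of that graph.
module GreedyBounds (i q : ℕ) .{{_ : NonZero i}} .{{_ : NonZero q}} where

  p : ℕ
  p = q * i

  instance
    p≢0 : NonZero p
    p≢0 = m*n≢0 q i

  h : ℕ → ℕ
  h a = Σ< a (λ y → i * (y / i))

  H : ℕ → ℕ
  H m = Σ< m (λ x → i * (x / p))

  h-+-≤ : ∀ x b → b ≤ i → h (x + b) ≤ h x + b * x
  h-+-≤ x b b≤i = ≤-trans (≤-reflexive (Σ<-split x b _)) (+-monoʳ-≤ (h x) (new≤ (b ≤? e)))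
    where
    K = x / i
    w = x % i
    e = i ∸ w
    w<i : w < i
    w<i = m%n<n x i
    i≡w+e : i ≡ w + e
    i≡w+e = sym (m+[n∸m]≡n (<⇒≤ w<i))
    x≡Ki+w : x ≡ K * i + w
    x≡Ki+w = m≡m%n+[m/n]*n x i ∙ +-comm w (K * i)
    iK≤x : i * K ≤ x
    iK≤x = subst₂ _≤_ (*-comm K i) (sym x≡Ki+w) (m≤m+n (K * i) w)

    new : ℕ → ℕ
    new z = i * ((x + z) / i)

    new-low : ∀ z → z < e → new z ≡ i * K
    new-low z z<e = cong (λ y → i * (y / i)) (cong (_+ z) x≡Ki+w ∙ +-assoc (K * i) w z)
                  ∙ cong (i *_) ([m*n+o]/n≡m K i (subst (w + z <_) (sym i≡w+e) (+-monoʳ-< w z<e)))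

    new-high : ∀ z → z < i → new (e + z) ≡ i * suc K
    new-high z z<i = cong (λ y → i * (y / i)) x+e+z≡ ∙ cong (i *_) ([m*n+o]/n≡m (suc K) i z<i)
      where
      regroup : ∀ a w e z → a + w + (e + z) ≡ (w + e) + a + z
      regroup = solve-∀
      x+e+z≡ : x + (e + z) ≡ suc K * i + z
      x+e+z≡ = cong (_+ (e + z)) x≡Ki+w ∙ regroup (K * i) w e z ∙ cong (λ k → k + K * i + z) (sym i≡w+e)

    -- The last b ∸ e of the new vertices spill over into the next part.
    carry : e ≤ b → Σ< b new ≤ b * x
    carry e≤b = +-cancelʳ-≤ (e * w) _ _ (begin
        Σ< b new + e * w                                  ≡⟨ cong (_+ e * w) Σnew≡ ⟩
        e * (i * K) + f * (i * suc K) + e * w             ≡⟨ cong (λ k → e * (k * K) + f * (k * suc K) + e * w) i≡w+e ⟩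
        e * ((w + e) * K) + f * ((w + e) * suc K) + e * w ≡⟨ expand w e f K ⟩
        (e + f) * (K * (w + e) + w) + e * f               ≡⟨ cong₂ (λ u v → u * (K * v + w) + e * f) (sym b≡e+f) (sym i≡w+e) ⟩
        b * (K * i + w) + e * f                           ≡⟨ cong (λ y → b * y + e * f) (sym x≡Ki+w) ⟩
        b * x + e * f                                     ≤⟨ +-monoʳ-≤ (b * x) (*-monoʳ-≤ e f≤w) ⟩
        b * x + e * w                                     ∎)
      where
      open ≤-Reasoning
      f = b ∸ e
      b≡e+f : b ≡ e + f
      b≡e+f = sym (m+[n∸m]≡n e≤b)
      f≤w : f ≤ w
      f≤w = +-cancelˡ-≤ e f w (subst₂ _≤_ b≡e+f (i≡w+e ∙ +-comm w e) b≤i)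
      Σnew≡ : Σ< b new ≡ e * (i * K) + f * (i * suc K)
      Σnew≡ = cong (λ k → Σ< k new) b≡e+f ∙ Σ<-split e f new
            ∙ cong₂ _+_ (Σ<-cong e new-low ∙ Σ<-const e (i * K))
                        (Σ<-cong f (λ z z<f → new-high z (<-≤-trans z<f (≤-trans f≤w (<⇒≤ w<i))))
                         ∙ Σ<-const f (i * suc K))
      expand : ∀ w e f K → e * ((w + e) * K) + f * ((w + e) * suc K) + e * w
                         ≡ (e + f) * (K * (w + e) + w) + e * f
      expand = solve-∀

    new≤ : Dec (b ≤ e) → Σ< b new ≤ b * x
    new≤ (yes b≤e) = ≤-trans (Σ<-mono-≤ b (λ z z<b → ≤-trans (≤-reflexive (new-low z (<-≤-trans z<b b≤e))) iK≤x))
                             (≤-reflexive (Σ<-const b x))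
    new≤ (no b≰e)  = carry (<⇒≤ (≰⇒> b≰e))

  h-Σ≤crossPairs : ∀ s (b : ℕ → ℕ) → (∀ j → j < s → b j ≤ i) → h (Σ< s b) ≤ crossPairs s b
  h-Σ≤crossPairs zero    b _    = z≤n
  h-Σ≤crossPairs (suc s) b b≤i = begin
      h (b 0 + B)                    ≡⟨ cong h (+-comm (b 0) B) ⟩
      h (B + b 0)                    ≤⟨ h-+-≤ B (b 0) (b≤i 0 z<s) ⟩
      h B + b 0 * B                  ≤⟨ +-monoˡ-≤ (b 0 * B) (h-Σ≤crossPairs s b′ (λ j j<s → b≤i (suc j) (s<s j<s))) ⟩
      crossPairs s b′ + b 0 * B      ≡⟨ +-comm (crossPairs s b′) (b 0 * B) ⟩
      b 0 * B + crossPairs s b′      ≡⟨ crossPairs-suc s b ⟨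
      crossPairs (suc s) b           ∎
    where
    open ≤-Reasoning
    b′ : ℕ → ℕ
    b′ j = b (suc j)
    B = Σ< s b′

  h-* : ∀ K → h (K * i) ≡ Σ< K (λ k → i * (i * k))
  h-* K = Σ<-blocks K i _
        ∙ Σ<-cong K (λ k _ → Σ<-cong i (λ t t<i → cong (i *_) ([m*n+o]/n≡m k i t<i)) ∙ Σ<-const i (i * k))

  H-*+ : ∀ K r → r < p → H (K * p + r) ≡ q * h (K * i) + r * (i * K)
  H-*+ K r r<p = Σ<-split (K * p) r _ ∙ cong₂ _+_ full-levels last-level
    where
    full-levels : Σ< (K * p) (λ x → i * (x / p)) ≡ q * h (K * i)
    full-levels = Σ<-blocks K p _
      ∙ Σ<-cong K (λ k _ → Σ<-cong p (λ t t<p → cong (i *_) ([m*n+o]/n≡m k p t<p))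
                          ∙ Σ<-const p (i * k) ∙ *-assoc q i (i * k))
      ∙ Σ<-*ˡ K q _ ∙ cong (q *_) (sym (h-* K))
    last-level : Σ< r (λ z → i * ((K * p + z) / p)) ≡ r * (i * K)
    last-level = Σ<-cong r (λ z z<r → cong (i *_) ([m*n+o]/n≡m K p (<-trans z<r r<p))) ∙ Σ<-const r (i * K)

  -- Compare every h (a g) with its supporting line at the multiple K * i of i nearest below the average.
  H-Σ≤Σh : ∀ (a : ℕ → ℕ) → H (Σ< q a) ≤ Σ< q (λ g → h (a g))
  H-Σ≤Σh a = +-cancelʳ-≤ Z _ _ (begin
      H m + Z                                          ≡⟨ cong (λ k → H k + Z) m≡Kp+r ⟩
      H (K * p + r) + Z                                ≡⟨ cong (_+ Z) (H-*+ K r (m%n<n m p)) ⟩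
      q * h (K * i) + r * σ + Z                        ≡⟨ +-assoc (q * h (K * i)) _ _ ⟩
      q * h (K * i) + (r * σ + Z)                      ≡⟨ cong (q * h (K * i) +_) (collect r σ q K i ∙ cong (σ *_) (sym m≡r+Kp)) ⟩
      q * h (K * i) + σ * m                            ≡⟨ cong₂ _+_ (sym (Σ<-const q _)) (sym (Σ<-*ˡ q σ a)) ⟩
      Σ< q (λ _ → h (K * i)) + Σ< q (λ g → σ * a g)    ≡⟨ Σ<-distrib-+ q _ _ ⟨
      Σ< q (λ g → h (K * i) + σ * a g)                 ≤⟨ Σ<-mono-≤ q (λ g _ → supporting (a g)) ⟩
      Σ< q (λ g → h (a g) + σ * (K * i))               ≡⟨ Σ<-distrib-+ q _ _ ⟩
      Σ< q (λ g → h (a g)) + Σ< q (λ _ → σ * (K * i))  ≡⟨ cong (Σ< q (λ g → h (a g)) +_) (Σ<-const q _) ⟩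
      Σ< q (λ g → h (a g)) + Z                         ∎)
    where
    open ≤-Reasoning
    m = Σ< q a
    K = m / p
    r = m % p
    σ = i * K
    Z = q * (σ * (K * i))
    m≡r+Kp : m ≡ r + K * p
    m≡r+Kp = m≡m%n+[m/n]*n m p
    m≡Kp+r : m ≡ K * p + r
    m≡Kp+r = m≡r+Kp ∙ +-comm r (K * p)
    collect : ∀ r σ q K i → r * σ + q * (σ * (K * i)) ≡ σ * (r + K * (q * i))
    collect = solve-∀
    supporting : ∀ a → h (K * i) + σ * a ≤ h a + σ * (K * i)
    supporting = Σ<-above-supporting-line (λ y → i * (y / i)) (K * i) σ
      (λ y y<Ki → *-monoʳ-≤ i (<⇒≤ (m<n*o⇒m/o<n y<Ki)))
      (λ y Ki≤y → *-monoʳ-≤ i (subst (_≤ y / i) (m*n/n≡m K i) (/-monoˡ-≤ i Ki≤y)))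

-- Counting pairs

count : ℕ → (ℕ → Bool) → ℕ
count n χ = Σ< n (λ x → ⟦ χ x ⟧)

pairsIn : ℕ → (ℕ → ℕ → Bool) → (ℕ → Bool) → ℕ
pairsIn n R χ = Σ< n (λ x → Σ< n (λ y → ⟦ χ x ∧ χ y ∧ R x y ⟧))

pairsBelow : ℕ → (ℕ → ℕ → Bool) → ℕ
pairsBelow m R = Σ< m (λ x → Σ< m (λ y → ⟦ R x y ⟧))

Strict : (ℕ → ℕ → Bool) → Set
Strict R = ∀ {x y} → R x y ≡ true → x < y

Strict⇒⟦⟧≡0 : ∀ {R} → Strict R → ∀ {x y} → ¬ x < y → ⟦ R x y ⟧ ≡ 0
Strict⇒⟦⟧≡0 {R} R⊆< {x} {y} x≮y with R x y in eq
... | false = refl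
... | true  = ⊥-elim (x≮y (R⊆< eq))

pairsIn-+ : ∀ n (R₁ R₂ R : ℕ → ℕ → Bool) χ → (∀ x y → ⟦ R₁ x y ⟧ + ⟦ R₂ x y ⟧ ≡ ⟦ R x y ⟧) →
            pairsIn n R₁ χ + pairsIn n R₂ χ ≡ pairsIn n R χ
pairsIn-+ n R₁ R₂ R χ R₁+R₂≡R = sym (Σ<-distrib-+ n _ _)
  ∙ Σ<-cong n (λ x _ → sym (Σ<-distrib-+ n _ _)
  ∙ Σ<-cong n (λ y _ → ∧-+ (χ x) (∧-+ (χ y) (R₁+R₂≡R x y))))
  where
  ∧-+ : ∀ c {a b d} → ⟦ a ⟧ + ⟦ b ⟧ ≡ ⟦ d ⟧ → ⟦ c ∧ a ⟧ + ⟦ c ∧ b ⟧ ≡ ⟦ c ∧ d ⟧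
  ∧-+ true  eq = eq
  ∧-+ false eq = refl

pairsIn-<ᵇ : ∀ n χ → pairsIn n _<ᵇ_ χ ≡ count n χ C 2
pairsIn-<ᵇ zero    χ = refl
pairsIn-<ᵇ (suc n) χ = cong₂ _+_ first-row other-rows ∙ choose (χ 0) (count n χ′)
  where
  χ′ : ℕ → Bool
  χ′ x = χ (suc x)
  ⟦∧∧false⟧ : ∀ a b → ⟦ a ∧ b ∧ false ⟧ ≡ 0
  ⟦∧∧false⟧ true  b = cong ⟦_⟧ (∧-zeroʳ b)
  ⟦∧∧false⟧ false b = refl
  ⟦∧∧true⟧ : ∀ a b → ⟦ a ∧ b ∧ true ⟧ ≡ ⟦ a ⟧ * ⟦ b ⟧
  ⟦∧∧true⟧ a b = cong (λ c → ⟦ a ∧ c ⟧) (∧-identityʳ b) ∙ ⟦∧⟧ a b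
  first-row : ⟦ χ 0 ∧ χ 0 ∧ false ⟧ + Σ< n (λ y → ⟦ χ 0 ∧ χ′ y ∧ true ⟧) ≡ ⟦ χ 0 ⟧ * count n χ′
  first-row = cong₂ _+_ (⟦∧∧false⟧ (χ 0) (χ 0))
                        (Σ<-cong n (λ y _ → ⟦∧∧true⟧ (χ 0) (χ′ y)) ∙ Σ<-*ˡ n ⟦ χ 0 ⟧ _)
  other-rows : Σ< n (λ x → ⟦ χ′ x ∧ χ 0 ∧ false ⟧ + Σ< n (λ y → ⟦ χ′ x ∧ χ′ y ∧ (x <ᵇ y) ⟧))
             ≡ count n χ′ C 2
  other-rows = Σ<-cong n (λ x _ → cong (_+ Σ< n (λ y → ⟦ χ′ x ∧ χ′ y ∧ (x <ᵇ y) ⟧)) (⟦∧∧false⟧ (χ′ x) (χ 0)))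
             ∙ pairsIn-<ᵇ n χ′
  choose : ∀ a c → ⟦ a ⟧ * c + c C 2 ≡ (⟦ a ⟧ + c) C 2
  choose true  c = cong (_+ c C 2) (+-identityʳ c ∙ sym (nC1≡n c)) ∙ nCk+nC[k+1]≡[n+1]C[k+1] c 1
  choose false c = refl

pairsIn-initial : ∀ {m n} R → m ≤ n → pairsIn n R (_<ᵇ m) ≡ pairsBelow m R
pairsIn-initial {m} {n} R m≤n = Σ<-cong n (λ x _ → row x) ∙ Σ<-restrict _ m≤n
  where
  row : ∀ x → Σ< n (λ y → ⟦ (x <ᵇ m) ∧ (y <ᵇ m) ∧ R x y ⟧) ≡ ⟦ x <ᵇ m ⟧ * Σ< m (λ y → ⟦ R x y ⟧)
  row x = Σ<-cong n (λ y _ → ⟦∧⟧ (x <ᵇ m) _ ∙ cong (⟦ x <ᵇ m ⟧ *_) (⟦∧⟧ (y <ᵇ m) _))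
        ∙ Σ<-*ˡ n ⟦ x <ᵇ m ⟧ _ ∙ cong (⟦ x <ᵇ m ⟧ *_) (Σ<-restrict _ m≤n)

pairsBelow-suc : ∀ m R → Strict R → pairsBelow (suc m) R ≡ pairsBelow m R + Σ< m (λ x → ⟦ R x m ⟧)
pairsBelow-suc m R R⊆< =
    Σ<-cong (suc m) (λ x _ → Σ<-suc m (λ y → ⟦ R x y ⟧))
  ∙ Σ<-distrib-+ (suc m) (λ x → Σ< m (λ y → ⟦ R x y ⟧)) (λ x → ⟦ R x m ⟧)
  ∙ cong₂ _+_ (Σ<-suc m _ ∙ cong (pairsBelow m R +_) last-row ∙ +-identityʳ _)
              (Σ<-suc m _ ∙ cong (Σ< m (λ x → ⟦ R x m ⟧) +_) (Strict⇒⟦⟧≡0 R⊆< (n≮n m)) ∙ +-identityʳ _)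
  where
  last-row : Σ< m (λ y → ⟦ R m y ⟧) ≡ 0
  last-row = Σ<-zero m (λ y y<m → Strict⇒⟦⟧≡0 R⊆< (<-asym y<m))

-- Edge counts of graphs on Fin k

member : ∀ {k} → Subset k → ℕ → Bool
member []      _       = false
member (b ∷ A) zero    = b
member (b ∷ A) (suc x) = member A x

lookup≡member : ∀ {k} (A : Subset k) u → lookup A u ≡ member A (toℕ u)
lookup≡member (b ∷ A) fzero    = refl
lookup≡member (b ∷ A) (fsuc u) = lookup≡member A u

∣∣≡count-member : ∀ {k} (A : Subset k) → ∣ A ∣ ≡ count k (member A)
∣∣≡count-member []          = refl
∣∣≡count-member (true ∷ A)  = cong suc (∣∣≡count-member A)
∣∣≡count-member (false ∷ A) = ∣∣≡count-member A

∣∣≡count : ∀ {k} (A : Subset k) χ → (∀ u → lookup A u ≡ χ (toℕ u)) → ∣ A ∣ ≡ count k χ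
∣∣≡count {k} A χ A≗χ = ∣∣≡count-member A ∙ Σ<-cong k (λ x x<k → cong ⟦_⟧ (member≡χ x<k))
  where
  member≡χ : ∀ {x} (x<k : x < k) → member A x ≡ χ x
  member≡χ x<k = cong (member A) (sym (toℕ-fromℕ< x<k)) ∙ sym (lookup≡member A (fromℕ< x<k))
               ∙ A≗χ (fromℕ< x<k) ∙ cong χ (toℕ-fromℕ< x<k)

edgesIn≡pairsIn : ∀ {k} (G : Graph k) (E : ℕ → ℕ → Bool) → (∀ u v → adj G u v ≡ E (toℕ u) (toℕ v)) →
                  ∀ (A : Subset k) χ → (∀ u → lookup A u ≡ χ (toℕ u)) →
                  edgesIn G A ≡ pairsIn k (λ x y → (x <ᵇ y) ∧ E x y) χ
edgesIn≡pairsIn {k} G E G≗E A χ A≗χ =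
    sumFin-cong {k} (λ u → sumFin-cong {k} (λ v →
      cong₂ (λ a b → ⟦ a ∧ b ∧ (toℕ u <ᵇ toℕ v) ∧ adj G u v ⟧) (A≗χ u) (A≗χ v)
      ∙ cong (λ e → ⟦ χ (toℕ u) ∧ χ (toℕ v) ∧ (toℕ u <ᵇ toℕ v) ∧ e ⟧) (G≗E u v)))
  ∙ sumFin-cong {k} (λ u → sumFin≡Σ< k (λ y → ⟦ χ (toℕ u) ∧ χ y ∧ (toℕ u <ᵇ y) ∧ E (toℕ u) y ⟧))
  ∙ sumFin≡Σ< k (λ x → Σ< k (λ y → ⟦ χ x ∧ χ y ∧ (x <ᵇ y) ∧ E x y ⟧))

foldr-⊔-lub : ∀ {X : Set} (f : X → ℕ) {b} (xs : List X) → (∀ x → f x ≤ b) → foldr (λ x acc → f x ⊔ acc) 0 xs ≤ b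
foldr-⊔-lub f []       _   = z≤n
foldr-⊔-lub f (x ∷ xs) f≤b = ⊔-lub (f≤b x) (foldr-⊔-lub f xs f≤b)

foldr-⊔-upper : ∀ {X : Set} (f : X → ℕ) {x} (xs : List X) → x ∈ xs → f x ≤ foldr (λ x acc → f x ⊔ acc) 0 xs
foldr-⊔-upper f (x ∷ xs) (here refl) = m≤m⊔n (f x) _
foldr-⊔-upper f (x ∷ xs) (there x∈) = m≤n⇒m≤o⊔n (f x) (foldr-⊔-upper f xs x∈)

∈-allSubsets : ∀ {k} (A : Subset k) → A ∈ allSubsets k
∈-allSubsets []          = here refl
∈-allSubsets (true ∷ A)  = ∈-++⁺ˡ (∈-map⁺ (true ∷_) (∈-allSubsets A))
∈-allSubsets {suc k} (false ∷ A) = ∈-++⁺ʳ (map (true ∷_) (allSubsets k)) (∈-map⁺ (false ∷_) (∈-allSubsets A))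

Imax-attained : ∀ {k} (G : Graph k) (f : ℕ → ℕ) {m} (A : Subset k) → (∀ B → edgesIn G B ≤ f ∣ B ∣) →
                ∣ A ∣ ≡ m → edgesIn G A ≡ f m → Imax G m ≡ f m
Imax-attained {k} G f {m} A edges≤f ∣A∣≡m A-attains =
  ≤-antisym (foldr-⊔-lub candidate (allSubsets k) candidate≤)
            (subst (_≤ Imax G m) candidate-A (foldr-⊔-upper candidate (allSubsets k) (∈-allSubsets A)))
  where
  candidate : Subset k → ℕ
  candidate B = if ∣ B ∣ ≡ᵇ m then edgesIn G B else 0
  candidate≤ : ∀ B → candidate B ≤ f m
  candidate≤ B with ∣ B ∣ ≡ᵇ m in eq
  ... | false = z≤n
  ... | true  = subst (λ l → edgesIn G B ≤ f l) (≡ᵇ≡true⇒≡ eq) (edges≤f B)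
  candidate-A : candidate A ≡ f m
  candidate-A rewrite ≡⇒≡ᵇ≡true ∣A∣≡m = A-attains

-- Vertex x lies on level x / p and in column (x % p) / i; x ≠ y are non-adjacent exactly when they
-- share a column but not a level.
module Construction (i q s : ℕ) .{{_ : NonZero i}} .{{_ : NonZero q}} where
  open GreedyBounds i q public

  n : ℕ
  n = s * p

  level : ℕ → ℕ
  level x = x / p

  column : ℕ → ℕ
  column x = x % p / i

  adjacent : ℕ → ℕ → Bool
  adjacent x y = not (x ≡ᵇ y) ∧ ((level x ≡ᵇ level y) ∨ not (column x ≡ᵇ column y))

  edge : ℕ → ℕ → Bool
  edge x y = (x <ᵇ y) ∧ adjacent x y

  nonEdge : ℕ → ℕ → Bool
  nonEdge x y = (column x ≡ᵇ column y) ∧ (level x <ᵇ level y)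

  adjacent-sym : ∀ x y → adjacent x y ≡ adjacent y x
  adjacent-sym x y rewrite ≡ᵇ-comm x y | ≡ᵇ-comm (level x) (level y) | ≡ᵇ-comm (column x) (column y) = refl

  adjacent-irrefl : ∀ x → adjacent x x ≡ false
  adjacent-irrefl x rewrite ≡ᵇ-refl x = refl

  level-<⇒< : ∀ {x y} → level x < level y → x < y
  level-<⇒< {x} {y} lx<ly with x <? y
  ... | yes x<y = x<y
  ... | no  x≮y = ⊥-elim (<⇒≱ lx<ly (/-monoˡ-≤ p (≮⇒≥ x≮y)))

  nonEdge-strict : Strict nonEdge
  nonEdge-strict {x} {y} eq with column x ≡ᵇ column y | level x <ᵇ level y in lx<ly
  ... | true | true = level-<⇒< (<ᵇ≡true⇒< lx<ly)

  edge+nonEdge : ∀ x y → ⟦ edge x y ⟧ + ⟦ nonEdge x y ⟧ ≡ ⟦ x <ᵇ y ⟧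
  edge+nonEdge x y with x <? y
  ... | no  x≮y rewrite ≮⇒<ᵇ≡false x≮y = Strict⇒⟦⟧≡0 nonEdge-strict x≮y
  ... | yes x<y rewrite <⇒<ᵇ≡true x<y | ≢⇒≡ᵇ≡false (<⇒≢ x<y)
                      | <ᵇ≡not≡ᵇ (/-monoˡ-≤ p (<⇒≤ x<y))
    = exactly-one (column x ≡ᵇ column y) (level x ≡ᵇ level y)
    where
    exactly-one : ∀ c e → ⟦ e ∨ not c ⟧ + ⟦ c ∧ not e ⟧ ≡ 1
    exactly-one true  true  = refl
    exactly-one true  false = refl
    exactly-one false true  = refl
    exactly-one false false = refl

  edges+nonEdges : ∀ χ → pairsIn n edge χ + pairsIn n nonEdge χ ≡ count n χ C 2
  edges+nonEdges χ = pairsIn-+ n edge nonEdge _<ᵇ_ χ edge+nonEdge ∙ pairsIn-<ᵇ n χ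

  vertex : ℕ → ℕ → ℕ → ℕ
  vertex j g t = j * p + (g * i + t)

  level-vertex : ∀ j {g t} → g < q → t < i → level (vertex j g t) ≡ j
  level-vertex j g<q t<i = [m*n+o]/n≡m j p (m<k∧o<n⇒m*n+o<k*n g<q t<i)

  column-vertex : ∀ j {g t} → g < q → t < i → column (vertex j g t) ≡ g
  column-vertex j {g} g<q t<i = cong (_/ i) ([m*n+o]%n≡o j p (m<k∧o<n⇒m*n+o<k*n g<q t<i)) ∙ [m*n+o]/n≡m g i t<i

  Σ<-vertices : ∀ F → Σ< n F ≡ Σ< s (λ j → Σ< q (λ g → Σ< i (λ t → F (vertex j g t))))
  Σ<-vertices F = Σ<-blocks s p F ∙ Σ<-cong s (λ j _ → Σ<-blocks q i (λ r → F (j * p + r)))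

  nonEdge-vertex : ∀ j g t j′ g′ t′ → g < q → t < i → g′ < q → t′ < i →
                   nonEdge (vertex j g t) (vertex j′ g′ t′) ≡ (g ≡ᵇ g′) ∧ (j <ᵇ j′)
  nonEdge-vertex j g t j′ g′ t′ g<q t<i g′<q t′<i =
    cong₂ _∧_ (cong₂ _≡ᵇ_ (column-vertex j g<q t<i) (column-vertex j′ g′<q t′<i))
              (cong₂ _<ᵇ_ (level-vertex j g<q t<i) (level-vertex j′ g′<q t′<i))

  -- Grouping the vertices of χ by column g and level j, with size g j of them in each cell, the
  -- non-edges inside column g are the cross pairs of a complete multipartite graph.
  module _ (χ : ℕ → Bool) where

    chosen : ℕ → ℕ → ℕ → ℕ
    chosen j g t = ⟦ χ (vertex j g t) ⟧

    size : ℕ → ℕ → ℕ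
    size g j = Σ< i (chosen j g)

    size≤i : ∀ g j → size g j ≤ i
    size≤i g j = ≤-trans (Σ<-mono-≤ i (λ t _ → ⟦⟧≤1 (χ (vertex j g t))))
                         (≤-reflexive (Σ<-const i 1 ∙ *-identityʳ i))

    count-columns : count n χ ≡ Σ< q (λ g → Σ< s (size g))
    count-columns = Σ<-vertices (λ x → ⟦ χ x ⟧) ∙ Σ<-comm s q (λ j g → size g j)

    nonEdges-from : ∀ j g t → g < q → t < i →
      Σ< n (λ y → ⟦ χ (vertex j g t) ∧ χ y ∧ nonEdge (vertex j g t) y ⟧)
      ≡ chosen j g t * Σ< s (λ j′ → ⟦ j <ᵇ j′ ⟧ * size g j′)
    nonEdges-from j g t g<q t<i = Σ<-vertices _
      ∙ Σ<-cong s (λ j′ _ → Σ<-cong q (λ g′ g′<q → Σ<-cong i (λ t′ t′<i → pointwise j′ g′ t′ g′<q t′<i)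
                                                 ∙ factor-out i ⟦ j <ᵇ j′ ⟧ (λ t′ → ⟦ g′ ≡ᵇ g ⟧ * chosen j′ g′ t′)
                                                 ∙ cong (λ k → c * (⟦ j <ᵇ j′ ⟧ * k)) (Σ<-*ˡ i ⟦ g′ ≡ᵇ g ⟧ _))
                          ∙ factor-out q ⟦ j <ᵇ j′ ⟧ (λ g′ → ⟦ g′ ≡ᵇ g ⟧ * size g′ j′)
                          ∙ cong (λ k → c * (⟦ j <ᵇ j′ ⟧ * k)) (Σ<-select q g (λ g′ → size g′ j′) g<q))
      ∙ Σ<-*ˡ s c _
      where
      c = chosen j g t
      factor-out : ∀ m l (f : ℕ → ℕ) → Σ< m (λ z → c * (l * f z)) ≡ c * (l * Σ< m f)
      factor-out m l f = Σ<-*ˡ m c _ ∙ cong (c *_) (Σ<-*ˡ m l f)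
      pointwise : ∀ j′ g′ t′ → g′ < q → t′ < i →
        ⟦ χ (vertex j g t) ∧ χ (vertex j′ g′ t′) ∧ nonEdge (vertex j g t) (vertex j′ g′ t′) ⟧
        ≡ c * (⟦ j <ᵇ j′ ⟧ * (⟦ g′ ≡ᵇ g ⟧ * chosen j′ g′ t′))
      pointwise j′ g′ t′ g′<q t′<i =
          cong (λ b → ⟦ χ (vertex j g t) ∧ χ (vertex j′ g′ t′) ∧ b ⟧) (nonEdge-vertex j g t j′ g′ t′ g<q t<i g′<q t′<i)
        ∙ ⟦∧⟧ (χ (vertex j g t)) _
        ∙ cong (c *_) (⟦∧⟧ (χ (vertex j′ g′ t′)) _ ∙ cong (chosen j′ g′ t′ *_) (⟦∧⟧ (g ≡ᵇ g′) _)
                      ∙ cong (λ e → chosen j′ g′ t′ * (⟦ e ⟧ * ⟦ j <ᵇ j′ ⟧)) (≡ᵇ-comm g g′)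
                      ∙ reorder (chosen j′ g′ t′) ⟦ g′ ≡ᵇ g ⟧ ⟦ j <ᵇ j′ ⟧)
        where
        reorder : ∀ a b l → a * (b * l) ≡ l * (b * a)
        reorder = solve-∀

    nonEdges-columns : pairsIn n nonEdge χ ≡ Σ< q (λ g → crossPairs s (size g))
    nonEdges-columns = Σ<-vertices _
      ∙ Σ<-cong s (λ j _ → Σ<-cong q (λ g g<q → Σ<-cong i (λ t t<i → nonEdges-from j g t g<q t<i)
                                              ∙ Σ<-*ʳ i _ (chosen j g)))
      ∙ Σ<-comm s q (λ j g → size g j * Σ< s (λ j′ → ⟦ j <ᵇ j′ ⟧ * size g j′))
      ∙ Σ<-cong q (λ g _ → Σ<-cong s (λ j _ → sym (Σ<-cong s (λ j′ _ → reorder ⟦ j <ᵇ j′ ⟧ (size g j) (size g j′))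
                                                  ∙ Σ<-*ˡ s (size g j) _)))
      where
      reorder : ∀ l a b → l * (a * b) ≡ a * (l * b)
      reorder = solve-∀

    H≤nonEdges : H (count n χ) ≤ pairsIn n nonEdge χ
    H≤nonEdges = begin
      H (count n χ)                          ≡⟨ cong H count-columns ⟩
      H (Σ< q (λ g → Σ< s (size g)))         ≤⟨ H-Σ≤Σh (λ g → Σ< s (size g)) ⟩
      Σ< q (λ g → h (Σ< s (size g)))         ≤⟨ Σ<-mono-≤ q (λ g _ → h-Σ≤crossPairs s (size g) (λ j _ → size≤i g j)) ⟩
      Σ< q (λ g → crossPairs s (size g))     ≡⟨ nonEdges-columns ⟨
      pairsIn n nonEdge χ                    ∎
      where open ≤-Reasoning

  U : ℕ → ℕ
  U zero    = 0
  U (suc k) = U k + (k ∸ i * level k)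

  i*level≤ : ∀ x → i * level x ≤ x
  i*level≤ x = begin
    i * (x / p)   ≤⟨ *-monoˡ-≤ (x / p) (m≤n*m i q) ⟩
    p * (x / p)   ≡⟨ *-comm p (x / p) ⟩
    x / p * p     ≤⟨ m/n*n≤m x p ⟩
    x             ∎
    where open ≤-Reasoning

  U+H≡C₂ : ∀ m → U m + H m ≡ m C 2
  U+H≡C₂ zero    = refl
  U+H≡C₂ (suc m) =
      cong (U (suc m) +_) (Σ<-suc m (λ x → i * (x / p)))
    ∙ regroup (U m) (H m) (m ∸ i * level m) (i * level m)
    ∙ cong₂ _+_ (U+H≡C₂ m) (m∸n+n≡m (i*level≤ m) ∙ sym (nC1≡n m))
    ∙ +-comm (m C 2) (m C 1) ∙ nCk+nC[k+1]≡[n+1]C[k+1] m 1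
    where
    regroup : ∀ a b c d → (a + c) + (b + d) ≡ (a + b) + (c + d)
    regroup = solve-∀

  edges≤U : ∀ χ → pairsIn n edge χ ≤ U (count n χ)
  edges≤U χ = +-cancelʳ-≤ (pairsIn n nonEdge χ) _ _ (begin
    pairsIn n edge χ + pairsIn n nonEdge χ ≡⟨ edges+nonEdges χ ⟩
    count n χ C 2                          ≡⟨ U+H≡C₂ (count n χ) ⟨
    U (count n χ) + H (count n χ)          ≤⟨ +-monoʳ-≤ (U (count n χ)) (H≤nonEdges χ) ⟩
    U (count n χ) + pairsIn n nonEdge χ    ∎)
    where open ≤-Reasoning

  nonEdges-to : ∀ m → m < n → Σ< m (λ x → ⟦ nonEdge x m ⟧) ≡ i * level m
  nonEdges-to m m<n =
      sym (Σ<-restrict _ (<⇒≤ m<n))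
    ∙ Σ<-cong n (λ x _ → only-below x)
    ∙ Σ<-vertices (λ x → ⟦ nonEdge x m ⟧)
    ∙ Σ<-cong s (λ j _ → Σ<-cong q (λ g g<q → Σ<-cong i (λ t t<i → pointwise j g t g<q t<i)
                                            ∙ Σ<-const i _ ∙ reorder i ⟦ g ≡ᵇ column m ⟧ ⟦ j <ᵇ level m ⟧)
                       ∙ Σ<-select q (column m) (λ _ → i * ⟦ j <ᵇ level m ⟧) column<q)
    ∙ Σ<-*ˡ s i _ ∙ cong (i *_) (Σ<-count< (<⇒≤ level<s))
    where
    column<q : column m < q
    column<q = m<n*o⇒m/o<n (m%n<n m p)
    level<s : level m < s
    level<s = m<n*o⇒m/o<n {n = s} m<n
    only-below : ∀ x → ⟦ x <ᵇ m ⟧ * ⟦ nonEdge x m ⟧ ≡ ⟦ nonEdge x m ⟧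
    only-below x with nonEdge x m in eq
    ... | true  rewrite <⇒<ᵇ≡true (nonEdge-strict eq) = refl
    ... | false = *-zeroʳ ⟦ x <ᵇ m ⟧
    pointwise : ∀ j g t → g < q → t < i → ⟦ nonEdge (vertex j g t) m ⟧ ≡ ⟦ g ≡ᵇ column m ⟧ * ⟦ j <ᵇ level m ⟧
    pointwise j g t g<q t<i =
      cong₂ (λ c l → ⟦ (c ≡ᵇ column m) ∧ (l <ᵇ level m) ⟧) (column-vertex j g<q t<i) (level-vertex j g<q t<i)
      ∙ ⟦∧⟧ (g ≡ᵇ column m) _
    reorder : ∀ i a b → i * (a * b) ≡ a * (i * b)
    reorder = solve-∀

  nonEdgesBelow : ∀ m → m ≤ n → pairsBelow m nonEdge ≡ H m
  nonEdgesBelow zero    _   = refl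
  nonEdgesBelow (suc m) m<n = pairsBelow-suc m nonEdge nonEdge-strict
    ∙ cong₂ _+_ (nonEdgesBelow m (<⇒≤ m<n)) (nonEdges-to m m<n) ∙ sym (Σ<-suc m (λ x → i * (x / p)))

  edges-initial : ∀ m → m ≤ n → pairsIn n edge (_<ᵇ m) ≡ U m
  edges-initial m m≤n = +-cancelʳ-≡ (H m) _ _ (
      cong (pairsIn n edge (_<ᵇ m) +_) (sym (pairsIn-initial nonEdge m≤n ∙ nonEdgesBelow m m≤n))
    ∙ edges+nonEdges (_<ᵇ m) ∙ cong (_C 2) (Σ<-count< m≤n) ∙ sym (U+H≡C₂ m))

  graph : Graph n
  graph = record
    { adj    = λ u v → adjacent (toℕ u) (toℕ v)
    ; sym    = λ u v → adjacent-sym (toℕ u) (toℕ v)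
    ; irrefl = λ v → adjacent-irrefl (toℕ v)
    }

  edgesIn-graph : ∀ A χ → (∀ u → lookup A u ≡ χ (toℕ u)) → edgesIn graph A ≡ pairsIn n edge χ
  edgesIn-graph = edgesIn≡pairsIn graph adjacent (λ _ _ → refl)

  initial : ℕ → Subset n
  initial = initialSegment idₚ

  initial-member : ∀ m u → lookup (initial m) u ≡ (toℕ u <ᵇ m)
  initial-member m u = lookup∘tabulate _ u

  ∣initial∣ : ∀ m → m ≤ n → ∣ initial m ∣ ≡ m
  ∣initial∣ m m≤n = ∣∣≡count (initial m) (_<ᵇ m) (initial-member m) ∙ Σ<-count< m≤n

  edgesIn-initial : ∀ m → m ≤ n → edgesIn graph (initial m) ≡ U m
  edgesIn-initial m m≤n = edgesIn-graph (initial m) (_<ᵇ m) (initial-member m) ∙ edges-initial m m≤n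

  edgesIn≤U : ∀ B → edgesIn graph B ≤ U ∣ B ∣
  edgesIn≤U B = subst₂ _≤_ (sym (edgesIn-graph B (member B) (lookup≡member B)))
                           (cong U (sym (∣∣≡count-member B))) (edges≤U (member B))

  Imax≡U : ∀ m → m ≤ n → Imax graph m ≡ U m
  Imax≡U m m≤n = Imax-attained graph U (initial m) edgesIn≤U (∣initial∣ m m≤n) (edgesIn-initial m m≤n)

  optimal : OptimalOrder graph idₚ
  optimal m m≤n = edgesIn-initial m m≤n ∙ sym (Imax≡U m m≤n) ∙ cong (Imax graph) (sym (∣initial∣ m m≤n))

  δ-graph : ∀ k → suc k ≤ n → δ graph (suc k) ≡ k ∸ i * level k
  δ-graph zero    _      = sym (0∸n≡0 (i * level 0))
  δ-graph (suc k) 2+k≤n = cong₂ _∸_ (Imax≡U (suc (suc k)) 2+k≤n) (Imax≡U (suc k) (<⇒≤ 2+k≤n))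
                        ∙ m+n∸m≡n (U (suc k)) _

  δ-values : ∀ j r → j < s → r < p → δ graph (j * p + r + 1) ≡ j * (p ∸ i) + r
  δ-values j r j<s r<p = cong (δ graph) (+-comm (j * p + r) 1)
                       ∙ δ-graph (j * p + r) (m<k∧o<n⇒m*n+o<k*n j<s r<p) ∙ closed-form
    where
    closed-form : (j * p + r) ∸ i * level (j * p + r) ≡ j * (p ∸ i) + r
    closed-form = cong (λ l → (j * p + r) ∸ i * l) ([m*n+o]/n≡m j p r<p)
                ∙ cong (j * p + r ∸_) (*-comm i j)
                ∙ +-∸-comm r (*-monoʳ-≤ j (m≤n*m i q)) ∙ cong (_+ r) (sym (*-distribˡ-∸ j p i))

theorem6 : (p s i : ℕ) → 1 ≤ p → 1 ≤ s → 1 ≤ i → i ∣ p →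
    Σ (Graph (s * p)) λ H →
    Σ (Permutation′ (s * p)) (λ σ → OptimalOrder H σ)
    × (∀ j r → j < s → r < p → δ H (j * p + r + 1) ≡ j * (p ∸ i) + r)
theorem6 .(q * i) s i 1≤p _ 1≤i (divides q refl) = graph , (idₚ , optimal) , δ-values
  where
  instance
    i≢0 : NonZero i
    i≢0 = >-nonZero 1≤i
    q≢0 : NonZero q
    q≢0 = m*n≢0⇒m≢0 q {{>-nonZero 1≤p}}
  open Construction i q s
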